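{- There is no $2.18$-competitive incremental algorithm for Region Choosing; i.e. there exists an instance of Region Choosing that admits no $2.18$-competitive incremental solution.
   Context: Region Choosing: given $N\in\mathbb N$, pairwise disjoint regions $R_1,\dots,R_N$ with $|R_i|=i$ and densities $\delta(i)\ge0$, ground set $\mathcal U=\bigcup_i R_i$ and objective $f(S)=\max_i|R_i\cap S|\,\delta(i)$ for $S\subseteq\mathcal U$. An incremental solution is an ordering $s_1,\dots,s_{|\mathcal U|}$ of $\mathcal U$; with $\vec S_k=\{s_1,\dots,s_k\}$ and $f^\star_k=\max\{f(S):|S|=k\}$, it is $\rho$-competitive if $f^\star_k/f(\vec S_k)\le\rho$ for all $k\in\{1,\dots,|\mathcal U|\}$. An algorithm is $\rho$-competitive if it outputs a $\rho$-competitive incremental solution on every instance. -}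

module Defs where

open import Data.Nat using (ℕ; suc; _≤_)
open import Data.Fin using (Fin; toℕ; _≟_)
open import Data.Integer using (+_)
open import Data.Rational using (ℚ; _/_; 0ℚ; _⊔_; _*_) renaming (_≤_ to _≤ℚ_)
open import Data.List using (List; length; filter; take; map; foldr; allFin)
open import Data.List.Relation.Unary.Unique.Propositional using (Unique)
open import Data.List.Membership.Propositional using (_∈_)
open import Data.Product using (Σ; proj₁; _×_)
open import Relation.Binary.PropositionalEquality using (_≡_)

-- Regions are indexed by i : Fin N; region i stands for R_{toℕ i + 1},
-- of size toℕ i + 1.  Elements of region i are Fin (suc (toℕ i)).
Elem : ℕ → Set
Elem N = Σ (Fin N) (λ i → Fin (suc (toℕ i)))

countIn : {N : ℕ} → Fin N → List (Elem N) → ℕ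
countIn i S = length (filter (λ e → proj₁ e ≟ i) S)

ℕtoℚ : ℕ → ℚ
ℕtoℚ n = + n / 1

-- f(S) = max_i |R_i ∩ S| δ(i)   (max of nonnegative values; 0 when N = 0)
f : {N : ℕ} → (Fin N → ℚ) → List (Elem N) → ℚ
f {N} δ S = foldr _⊔_ 0ℚ (map (λ i → ℕtoℚ (countIn i S) * δ i) (allFin N))

IsOrdering : {N : ℕ} → List (Elem N) → Set
IsOrdering {N} σ = Unique σ × ((x : Elem N) → x ∈ σ)

-- ρ-competitive: for all k ∈ {1..|U|} and all S ⊆ U with |S| = k,
-- f(S) ≤ ρ · f(S⃗_k)  (equivalently f*_k / f(S⃗_k) ≤ ρ)
Competitive : {N : ℕ} → ℚ → (Fin N → ℚ) → List (Elem N) → Set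
Competitive {N} ρ δ σ =
  (k : ℕ) → 1 ≤ k → k ≤ length σ →
  (S : List (Elem N)) → Unique S → length S ≡ k → f δ S ≤ℚ ρ * f δ (take k σ)

-- The density of a region of size s is 1/⌊s^(1/7)⌋, so a full region of size s is worth about
-- s^(6/7).  At a checkpoint k = (K m)^7 the region of size k alone is worth (K m)^6, so among the
-- first k elements of a 2.18-competitive order some "heavy" region has value at least (A m)^6
-- (as (K/A)^6 ≥ 2.18), and hence side ⌊|R|^(1/7)⌋ ≥ A m − 2.  Link every time t to the last
-- earlier time whose heavy region is smaller: the heavy regions along such a chain are distinct
-- and all lie among the first (K t)^7 elements.  A lower bound z on the fraction of (A t)^7 they
-- occupy improves at each link to z / (ℓ/d − z + 1/E)^7 + 1 − 1/E, while time at most triples.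
-- As z cannot outgrow the budget, chains have at most 27 links and end before M = 3^28 m₀ + 1.

module Submission where

module Root where

  open import Data.Nat
  open import Data.Nat.Properties
  open import Data.Empty using (⊥-elim)
  open import Relation.Binary using (tri<; tri≈; tri>)
  open import Relation.Binary.PropositionalEquality
  open import Relation.Nullary using (yes; no)

  0^n≡0 : ∀ n .{{_ : NonZero n}} → 0 ^ n ≡ 0
  0^n≡0 (suc n) = refl

  n≤n^k : ∀ n k .{{_ : NonZero k}} → n ≤ n ^ k
  n≤n^k zero k = z≤n
  n≤n^k n@(suc _) k = begin
    n ≡⟨ sym (*-identityʳ n) ⟩
    n ^ 1 ≤⟨ ^-monoʳ-≤ n (>-nonZero⁻¹ k) ⟩
    n ^ k ∎
    where open ≤-Reasoning

  module _ (k : ℕ) .{{_ : NonZero k}} where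

    abstract

      rootBelow : ℕ → ℕ → ℕ
      rootBelow s zero = 0
      rootBelow s (suc r) with suc r ^ k ≤? s
      ... | yes _ = suc r
      ... | no _ = rootBelow s r

      rootBelow-^≤ : ∀ s r → rootBelow s r ^ k ≤ s
      rootBelow-^≤ s zero = subst (_≤ s) (sym (0^n≡0 k)) z≤n
      rootBelow-^≤ s (suc r) with suc r ^ k ≤? s
      ... | yes r^k≤s = r^k≤s
      ... | no _ = rootBelow-^≤ s r

      rootBelow-maximal : ∀ s r q → rootBelow s r < q → q ≤ r → s < q ^ k
      rootBelow-maximal s zero q lt q≤0 = ⊥-elim (<⇒≱ lt q≤0)
      rootBelow-maximal s (suc r) q lt q≤r with suc r ^ k ≤? s
      ... | yes _ = ⊥-elim (<⇒≱ lt q≤r)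
      ... | no r^k≰s with q ≟ suc r
      ...   | yes refl = ≰⇒> r^k≰s
      ...   | no q≢r = rootBelow-maximal s r q lt (m<1+n⇒m≤n (≤∧≢⇒< q≤r q≢r))

      root : ℕ → ℕ
      root s = rootBelow s s

      root-^≤ : ∀ s → root s ^ k ≤ s
      root-^≤ s = rootBelow-^≤ s s

      <suc-root-^ : ∀ s → s < suc (root s) ^ k
      <suc-root-^ s with suc (root s) ≤? s
      ... | yes r<s = rootBelow-maximal s s (suc (root s)) ≤-refl r<s
      ... | no r≮s = <-≤-trans (≰⇒> r≮s) (n≤n^k (suc (root s)) k)

      root-unique : ∀ s c → c ^ k ≤ s → s < suc c ^ k → root s ≡ c
      root-unique s c lo hi with <-cmp (root s) c
      ... | tri≈ _ eq _ = eq
      ... | tri< lt _ _ = ⊥-elim (<⇒≱ (<suc-root-^ s) (≤-trans (^-monoˡ-≤ k lt) lo))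
      ... | tri> _ _ gt = ⊥-elim (<⇒≱ hi (≤-trans (^-monoˡ-≤ k gt) (root-^≤ s)))

      root-mono-≤ : ∀ {s t} → s ≤ t → root s ≤ root t
      root-mono-≤ {s} {t} s≤t with root s ≤? root t
      ... | yes le = le
      ... | no nle = ⊥-elim (<⇒≱ (<suc-root-^ t) (begin
        suc (root t) ^ k ≤⟨ ^-monoˡ-≤ k (≰⇒> nle) ⟩
        root s ^ k ≤⟨ root-^≤ s ⟩
        s ≤⟨ s≤t ⟩
        t ∎))
        where open ≤-Reasoning

      root-nonZero : ∀ s → .{{NonZero s}} → NonZero (root s)
      root-nonZero s with root s | <suc-root-^ s
      ... | suc _ | _ = _
      ... | zero | s<1 rewrite ^-zeroˡ k = ⊥-elim (<⇒≱ s<1 (>-nonZero⁻¹ s))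

module Arithmetic where

  open import Data.Nat
  open import Data.Nat.Properties
  open import Data.Nat.Tactic.RingSolver using (solve-∀)
  open import Data.Empty using (⊥-elim)
  open import Relation.Binary.PropositionalEquality
  open import Relation.Nullary using (yes; no)

  ^-distrib-* : ∀ m n k → (m * n) ^ k ≡ m ^ k * n ^ k
  ^-distrib-* m n zero = refl
  ^-distrib-* m n (suc k) = begin
    m * n * (m * n) ^ k ≡⟨ cong (m * n *_) (^-distrib-* m n k) ⟩
    m * n * (m ^ k * n ^ k) ≡⟨ interchange m n (m ^ k) (n ^ k) ⟩
    m * m ^ k * (n * n ^ k) ∎
    where
    open ≡-Reasoning
    interchange : ∀ m n x y → m * n * (x * y) ≡ m * x * (n * y)
    interchange = solve-∀

  m+n≤o⇒n≤o∸m : ∀ {m n o} → m + n ≤ o → n ≤ o ∸ m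
  m+n≤o⇒n≤o∸m {m} {n} {o} le = begin
    n ≡⟨ sym (m+n∸m≡n m n) ⟩
    m + n ∸ m ≤⟨ ∸-monoˡ-≤ m le ⟩
    o ∸ m ∎
    where open ≤-Reasoning

  *-^-scale : ∀ {c e x y} k m → c * x ^ k ≤ e * y ^ k → c * (x * m) ^ k ≤ e * (y * m) ^ k
  *-^-scale {c} {e} {x} {y} k m le = begin
    c * (x * m) ^ k ≡⟨ cong (c *_) (^-distrib-* x m k) ⟩
    c * (x ^ k * m ^ k) ≡⟨ sym (*-assoc c (x ^ k) (m ^ k)) ⟩
    c * x ^ k * m ^ k ≤⟨ *-monoˡ-≤ (m ^ k) le ⟩
    e * y ^ k * m ^ k ≡⟨ *-assoc e (y ^ k) (m ^ k) ⟩
    e * (y ^ k * m ^ k) ≡⟨ cong (e *_) (sym (^-distrib-* y m k)) ⟩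
    e * (y * m) ^ k ∎
    where open ≤-Reasoning

  bernoulli : ∀ k y → y ^ suc k + 2 * suc k * y ^ k ≤ (y + 2) ^ suc k
  bernoulli zero y = ≤-reflexive (base y)
    where
    base : ∀ y → y * 1 + 2 * 1 * 1 ≡ (y + 2) * 1
    base = solve-∀
  bernoulli (suc k) y = begin
    y * (y * Y) + 2 * suc (suc k) * (y * Y) ≤⟨ m≤m+n _ (4 * suc k * Y) ⟩
    y * (y * Y) + 2 * suc (suc k) * (y * Y) + 4 * suc k * Y ≡⟨ factor y Y k ⟩
    (y + 2) * (y * Y + 2 * suc k * Y) ≤⟨ *-monoʳ-≤ (y + 2) (bernoulli k y) ⟩
    (y + 2) * (y + 2) ^ suc k ∎
    where
    open ≤-Reasoning
    Y = y ^ k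
    factor : ∀ y Y k → y * (y * Y) + 2 * suc (suc k) * (y * Y) + 4 * suc k * Y
                     ≡ (y + 2) * (y * Y + 2 * suc k * Y)
    factor = solve-∀

  -- (n + 1) ^ (k + 2) ≤ n (n + 3) ^ (k + 1) for n ≥ 1, by Bernoulli.
  ^-*-<⇒≤+2 : ∀ {ν n} k → 0 < n → ν ^ suc k * n < suc n ^ suc (suc k) → ν ≤ n + 2
  ^-*-<⇒≤+2 {ν} {n} k 0<n lt with ν ≤? n + 2
  ... | yes ν≤ = ν≤
  ... | no ν≰ = ⊥-elim (<⇒≱ lt (begin
    suc n * (suc n * X) ≡⟨ split n X ⟩
    n * (suc n * X) + suc n * X ≤⟨ +-monoʳ-≤ (n * (suc n * X)) (*-monoˡ-≤ X suc-n≤) ⟩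
    n * (suc n * X) + 2 * suc k * n * X ≡⟨ merge n (suc n * X) X (suc k) ⟩
    n * (suc n * X + 2 * suc k * X) ≤⟨ *-monoʳ-≤ n (bernoulli k (suc n)) ⟩
    n * (suc n + 2) ^ suc k ≤⟨ *-monoʳ-≤ n (^-monoˡ-≤ (suc k) (≰⇒> ν≰)) ⟩
    n * ν ^ suc k ≡⟨ *-comm n (ν ^ suc k) ⟩
    ν ^ suc k * n ∎))
    where
    open ≤-Reasoning
    X = suc n ^ k
    suc-n≤ : suc n ≤ 2 * suc k * n
    suc-n≤ = begin
      suc n ≤⟨ +-monoˡ-≤ n 0<n ⟩
      n + n ≡⟨ cong (n +_) (sym (+-identityʳ n)) ⟩
      2 * n ≤⟨ *-monoˡ-≤ n (*-monoʳ-≤ 2 {1} {suc k} (s≤s z≤n)) ⟩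
      2 * suc k * n ∎
    split : ∀ n X → suc n * (suc n * X) ≡ n * (suc n * X) + suc n * X
    split = solve-∀
    merge : ∀ n Y X k → n * Y + 2 * k * n * X ≡ n * (Y + 2 * k * X)
    merge = solve-∀

  growth-base : ∀ {A K m₀ t n n'} → 0 < A → 0 < m₀ → K ^ 7 + 2 * A ^ 6 ≤ 3 * A ^ 7 →
    (A * m₀) ^ 6 * n' ≤ (K * m₀) ^ 7 → n ≤ n' → A * t ≤ n + 2 → t ≤ 3 * m₀
  growth-base {A} {K} {m₀} {t} {n} {n'} 0<A 0<m₀ constants weight n≤n' At≤ =
    *-cancelˡ-≤ (A ^ 7) {{m^n≢0 A 7 {{>-nonZero 0<A}}}} (begin
      A * A ^ 6 * t ≡⟨ e₁ A (A ^ 6) t ⟩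
      A ^ 6 * (A * t) ≤⟨ *-monoʳ-≤ (A ^ 6) At≤ ⟩
      A ^ 6 * (n + 2) ≡⟨ e₂ (A ^ 6) n ⟩
      A ^ 6 * n + 2 * A ^ 6 ≤⟨ +-mono-≤ An≤ (m≤m*n (2 * A ^ 6) m₀ {{>-nonZero 0<m₀}}) ⟩
      K ^ 7 * m₀ + 2 * A ^ 6 * m₀ ≡⟨ e₃ (K ^ 7) m₀ (A ^ 6) ⟩
      (K ^ 7 + 2 * A ^ 6) * m₀ ≤⟨ *-monoˡ-≤ m₀ constants ⟩
      3 * (A * A ^ 6) * m₀ ≡⟨ e₄ A (A ^ 6) m₀ ⟩
      A * A ^ 6 * (3 * m₀) ∎)
    where
    open ≤-Reasoning
    e₁ : ∀ A X t → A * X * t ≡ X * (A * t)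
    e₁ = solve-∀
    e₂ : ∀ X n → X * (n + 2) ≡ X * n + 2 * X
    e₂ = solve-∀
    e₃ : ∀ K m X → K * m + 2 * X * m ≡ (K + 2 * X) * m
    e₃ = solve-∀
    e₄ : ∀ A X m → 3 * (A * X) * m ≡ A * X * (3 * m)
    e₄ = solve-∀
    e₅ : ∀ X n Y → X * n * Y ≡ X * Y * n
    e₅ = solve-∀
    An≤ : A ^ 6 * n ≤ K ^ 7 * m₀
    An≤ = *-cancelʳ-≤ _ _ (m₀ ^ 6) {{m^n≢0 m₀ 6 {{>-nonZero 0<m₀}}}} (begin
      A ^ 6 * n * m₀ ^ 6 ≡⟨ e₅ (A ^ 6) n (m₀ ^ 6) ⟩
      A ^ 6 * m₀ ^ 6 * n ≡⟨ cong (_* n) (sym (^-distrib-* A m₀ 6)) ⟩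
      (A * m₀) ^ 6 * n ≤⟨ *-monoʳ-≤ ((A * m₀) ^ 6) n≤n' ⟩
      (A * m₀) ^ 6 * n' ≤⟨ weight ⟩
      (K * m₀) ^ 7 ≡⟨ ^-distrib-* K m₀ 7 ⟩
      K ^ 7 * (m₀ * m₀ ^ 6) ≡⟨ sym (*-assoc (K ^ 7) m₀ (m₀ ^ 6)) ⟩
      K ^ 7 * m₀ * m₀ ^ 6 ∎)

  consecutive-scale : ∀ {K A G H d ℓ m₀ p} → 0 < H →
    H * K ≤ (G * A ∸ H * K) * m₀ → H * K ≤ G * A → d * G ^ 7 ≤ ℓ * H ^ 7 → m₀ ≤ p →
    d * (K * suc p) ^ 7 ≤ ℓ * (A * p) ^ 7
  consecutive-scale {K} {A} {G} {H} {d} {ℓ} {m₀} {p} 0<H HK≤ HK≤GA dG≤ℓH m₀≤p =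
    *-cancelʳ-≤ _ _ (H ^ 7) {{m^n≢0 H 7 {{>-nonZero 0<H}}}} (begin
      d * (K * suc p) ^ 7 * H ^ 7 ≡⟨ e₂ d ((K * suc p) ^ 7) (H ^ 7) ⟩
      d * (H ^ 7 * (K * suc p) ^ 7) ≡⟨ cong (d *_) (sym (^-distrib-* H (K * suc p) 7)) ⟩
      d * (H * (K * suc p)) ^ 7 ≤⟨ *-monoʳ-≤ d (^-monoˡ-≤ 7 ratio) ⟩
      d * (G * (A * p)) ^ 7 ≡⟨ cong (d *_) (^-distrib-* G (A * p) 7) ⟩
      d * (G ^ 7 * (A * p) ^ 7) ≡⟨ sym (*-assoc d (G ^ 7) _) ⟩
      d * G ^ 7 * (A * p) ^ 7 ≤⟨ *-monoˡ-≤ ((A * p) ^ 7) dG≤ℓH ⟩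
      ℓ * H ^ 7 * (A * p) ^ 7 ≡⟨ e₃ ℓ (H ^ 7) ((A * p) ^ 7) ⟩
      ℓ * (A * p) ^ 7 * H ^ 7 ∎)
    where
    open ≤-Reasoning
    e₁ : ∀ H K p → H * (K * suc p) ≡ H * K * p + H * K
    e₁ = solve-∀
    e₂ : ∀ d x h → d * x * h ≡ d * (h * x)
    e₂ = solve-∀
    e₃ : ∀ ℓ h x → ℓ * h * x ≡ ℓ * x * h
    e₃ = solve-∀
    ratio : H * (K * suc p) ≤ G * (A * p)
    ratio = begin
      H * (K * suc p) ≡⟨ e₁ H K p ⟩
      H * K * p + H * K ≤⟨ +-monoʳ-≤ (H * K * p) (≤-trans HK≤ (*-monoʳ-≤ (G * A ∸ H * K) m₀≤p)) ⟩
      H * K * p + (G * A ∸ H * K) * p ≡⟨ sym (*-distribʳ-+ p (H * K) (G * A ∸ H * K)) ⟩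
      (H * K + (G * A ∸ H * K)) * p ≡⟨ cong (_* p) (m+[n∸m]≡n HK≤GA) ⟩
      G * A * p ≡⟨ *-assoc G A p ⟩
      G * (A * p) ∎

  module Recurrence (b ℓ d E : ℕ) where

    den : ℕ → ℕ
    den a = (b * ℓ ∸ d * a) * E + d * b

    -- With z = a/b, den a / (E d b) = ℓ/d − z + 1/E and Improves a a' says
    -- a'/b ≤ z (E d b / den a)^7 + 1 − 1/E.
    Improves : ℕ → ℕ → Set
    Improves a a' = a' * den a ^ 7 * E ≤ a * (E * d * b) ^ 7 * E + (E ∸ 1) * b * den a ^ 7

    capacity : ∀ {a C P n} → 0 < P → a * P ^ 7 ≤ b * C → d * (C + P ^ 6 * n) ≤ ℓ * P ^ 7 →
      d * b * n ≤ (b * ℓ ∸ d * a) * P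
    capacity {a} {C} {P} {n} 0<P aP≤bC budget =
      *-cancelʳ-≤ _ _ (P ^ 6) {{m^n≢0 P 6 {{>-nonZero 0<P}}}} (begin
        d * b * n * P ^ 6 ≡⟨ e₂ d b n (P ^ 6) ⟩
        d * b * (P ^ 6 * n) ≤⟨ m+n≤o⇒n≤o∸m total ⟩
        b * ℓ * P ^ 7 ∸ d * a * P ^ 7 ≡⟨ sym (*-distribʳ-∸ (P ^ 7) (b * ℓ) (d * a)) ⟩
        (b * ℓ ∸ d * a) * (P * P ^ 6) ≡⟨ sym (*-assoc (b * ℓ ∸ d * a) P (P ^ 6)) ⟩
        (b * ℓ ∸ d * a) * P * P ^ 6 ∎)
      where
      open ≤-Reasoning
      e₁ : ∀ d b C x → d * (b * C) + d * b * x ≡ b * (d * (C + x))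
      e₁ = solve-∀
      e₂ : ∀ d b n x → d * b * n * x ≡ d * b * (x * n)
      e₂ = solve-∀
      total : d * a * P ^ 7 + d * b * (P ^ 6 * n) ≤ b * ℓ * P ^ 7
      total = begin
        d * a * P ^ 7 + d * b * (P ^ 6 * n) ≡⟨ cong (_+ d * b * (P ^ 6 * n)) (*-assoc d a (P ^ 7)) ⟩
        d * (a * P ^ 7) + d * b * (P ^ 6 * n) ≤⟨ +-monoˡ-≤ _ (*-monoʳ-≤ d aP≤bC) ⟩
        d * (b * C) + d * b * (P ^ 6 * n) ≡⟨ e₁ d b C (P ^ 6 * n) ⟩
        b * (d * (C + P ^ 6 * n)) ≤⟨ *-monoʳ-≤ b budget ⟩
        b * (ℓ * P ^ 7) ≡⟨ sym (*-assoc b ℓ (P ^ 7)) ⟩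
        b * ℓ * P ^ 7 ∎

    den-bound : ∀ {a P T n} → d * b * n ≤ (b * ℓ ∸ d * a) * P → T ≤ n + 2 → 2 * E ≤ P →
      E * d * b * T ≤ den a * P
    den-bound {a} {P} {T} {n} cap T≤ 2E≤P = begin
      E * d * b * T ≤⟨ *-monoʳ-≤ (E * d * b) T≤ ⟩
      E * d * b * (n + 2) ≡⟨ e₁ E d b n ⟩
      E * (d * b * n) + d * b * (2 * E) ≤⟨ +-mono-≤ (*-monoʳ-≤ E cap) (*-monoʳ-≤ (d * b) 2E≤P) ⟩
      E * ((b * ℓ ∸ d * a) * P) + d * b * P ≡⟨ e₂ E (b * ℓ ∸ d * a) P (d * b) ⟩
      den a * P ∎
      where
      open ≤-Reasoning
      e₁ : ∀ E d b n → E * d * b * (n + 2) ≡ E * (d * b * n) + d * b * (2 * E)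
      e₁ = solve-∀
      e₂ : ∀ E x P y → E * (x * P) + y * P ≡ (x * E + y) * P
      e₂ = solve-∀

    side-slack : ∀ {T n} → T ≤ n + 2 → 2 * E ≤ T → (E ∸ 1) * T ≤ E * n
    side-slack {T} {n} T≤ 2E≤T = begin
      (E ∸ 1) * T ≡⟨ *-distribʳ-∸ T E 1 ⟩
      E * T ∸ 1 * T ≡⟨ cong (E * T ∸_) (*-identityˡ T) ⟩
      E * T ∸ T ≤⟨ ∸-monoˡ-≤ T (*-monoʳ-≤ E T≤) ⟩
      E * (n + 2) ∸ T ≡⟨ cong (_∸ T) (e E n) ⟩
      E * n + 2 * E ∸ T ≤⟨ ∸-monoˡ-≤ T (+-monoʳ-≤ (E * n) 2E≤T) ⟩
      E * n + T ∸ T ≡⟨ m+n∸n≡m (E * n) T ⟩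
      E * n ∎
      where
      open ≤-Reasoning
      e : ∀ E n → E * (n + 2) ≡ E * n + 2 * E
      e = solve-∀

    ratio-base : ∀ {a T n} → 0 < E → a * E ≤ b * (E ∸ 1) → (E ∸ 1) * T ≤ E * n →
      a * T ^ 7 ≤ b * (T ^ 6 * n)
    ratio-base {a} {T} {n} 0<E aE≤ slack = *-cancelʳ-≤ _ _ E {{>-nonZero 0<E}} (begin
      a * (T * T ^ 6) * E ≡⟨ e₁ a T (T ^ 6) E ⟩
      a * E * T * T ^ 6 ≤⟨ *-monoˡ-≤ (T ^ 6) (*-monoˡ-≤ T aE≤) ⟩
      b * (E ∸ 1) * T * T ^ 6 ≡⟨ e₂ b (E ∸ 1) T (T ^ 6) ⟩
      b * T ^ 6 * ((E ∸ 1) * T) ≤⟨ *-monoʳ-≤ (b * T ^ 6) slack ⟩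
      b * T ^ 6 * (E * n) ≡⟨ e₃ b (T ^ 6) E n ⟩
      b * (T ^ 6 * n) * E ∎)
      where
      open ≤-Reasoning
      e₁ : ∀ a T X E → a * (T * X) * E ≡ a * E * T * X
      e₁ = solve-∀
      e₂ : ∀ b e T X → b * e * T * X ≡ b * X * (e * T)
      e₂ = solve-∀
      e₃ : ∀ b X E n → b * X * (E * n) ≡ b * (X * n) * E
      e₃ = solve-∀

    ratio-step : ∀ {a a' P T n C} → 0 < d * b → 0 < E → Improves a a' →
      a * P ^ 7 ≤ b * C → E * d * b * T ≤ den a * P → (E ∸ 1) * T ≤ E * n →
      a' * T ^ 7 ≤ b * (C + T ^ 6 * n)
    ratio-step {a} {a'} {P} {T} {n} {C} 0<db 0<E improves aP≤bC time slack =
      *-cancelʳ-≤ _ _ (D ^ 7 * E) {{D⁷E≢0}} (begin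
        a' * T ^ 7 * (D ^ 7 * E) ≡⟨ e₁ a' (T ^ 7) (D ^ 7) E ⟩
        a' * D ^ 7 * E * T ^ 7 ≤⟨ *-monoˡ-≤ (T ^ 7) improves ⟩
        (a * F ^ 7 * E + (E ∸ 1) * b * D ^ 7) * (T * T ^ 6) ≡⟨ e₂ a (F ^ 7) E (E ∸ 1) b (D ^ 7) T (T ^ 6) ⟩
        E * a * (F ^ 7 * T ^ 7) + b * D ^ 7 * T ^ 6 * ((E ∸ 1) * T)
          ≤⟨ +-mono-≤ (*-monoʳ-≤ (E * a) time⁷) (*-monoʳ-≤ (b * D ^ 7 * T ^ 6) slack) ⟩
        E * a * (D ^ 7 * P ^ 7) + b * D ^ 7 * T ^ 6 * (E * n) ≡⟨ e₃ E a (D ^ 7) (P ^ 7) b (T ^ 6) n ⟩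
        E * D ^ 7 * (a * P ^ 7) + b * D ^ 7 * T ^ 6 * (E * n) ≤⟨ +-monoˡ-≤ _ (*-monoʳ-≤ (E * D ^ 7) aP≤bC) ⟩
        E * D ^ 7 * (b * C) + b * D ^ 7 * T ^ 6 * (E * n) ≡⟨ e₄ E (D ^ 7) b C (T ^ 6) n ⟩
        b * (C + T ^ 6 * n) * (D ^ 7 * E) ∎)
      where
      open ≤-Reasoning
      D = den a
      F = E * d * b
      D⁷E≢0 : NonZero (D ^ 7 * E)
      D⁷E≢0 = >-nonZero (*-mono-≤ (m^n>0 D {{>-nonZero (≤-trans 0<db (m≤n+m (d * b) _))}} 7) 0<E)
      time⁷ : F ^ 7 * T ^ 7 ≤ D ^ 7 * P ^ 7
      time⁷ = begin
        F ^ 7 * T ^ 7 ≡⟨ sym (^-distrib-* F T 7) ⟩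
        (F * T) ^ 7 ≤⟨ ^-monoˡ-≤ 7 time ⟩
        (D * P) ^ 7 ≡⟨ ^-distrib-* D P 7 ⟩
        D ^ 7 * P ^ 7 ∎
      e₁ : ∀ a x y z → a * x * (y * z) ≡ a * y * z * x
      e₁ = solve-∀
      e₂ : ∀ a F E E₁ b D T T₆ → (a * F * E + E₁ * b * D) * (T * T₆)
                                ≡ E * a * (F * (T * T₆)) + b * D * T₆ * (E₁ * T)
      e₂ = solve-∀
      e₃ : ∀ E a D P b T₆ n → E * a * (D * P) + b * D * T₆ * (E * n)
                             ≡ E * D * (a * P) + b * D * T₆ * (E * n)
      e₃ = solve-∀
      e₄ : ∀ E D b C T₆ n → E * D * (b * C) + b * D * T₆ * (E * n) ≡ b * (C + T₆ * n) * (D * E)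
      e₄ = solve-∀

    growth-step : ∀ {a P T n} → 0 < d * b → ℓ + 1 ≤ 3 * d →
      d * b * n ≤ (b * ℓ ∸ d * a) * P → T ≤ n + 2 → 2 * d ≤ P → T ≤ 3 * P
    growth-step {a} {P} {T} {n} 0<db ℓ+1≤3d cap T≤ 2d≤P =
      *-cancelˡ-≤ (d * b) {{>-nonZero 0<db}} (begin
        d * b * T ≤⟨ *-monoʳ-≤ (d * b) T≤ ⟩
        d * b * (n + 2) ≡⟨ e₁ d b n ⟩
        d * b * n + b * (2 * d)
          ≤⟨ +-mono-≤ (≤-trans cap (*-monoˡ-≤ P (m∸n≤m (b * ℓ) (d * a)))) (*-monoʳ-≤ b 2d≤P) ⟩
        b * ℓ * P + b * P ≡⟨ e₂ b ℓ P ⟩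
        b * P * (ℓ + 1) ≤⟨ *-monoʳ-≤ (b * P) ℓ+1≤3d ⟩
        b * P * (3 * d) ≡⟨ e₃ b P d ⟩
        d * b * (3 * P) ∎)
      where
      open ≤-Reasoning
      e₁ : ∀ d b n → d * b * (n + 2) ≡ d * b * n + b * (2 * d)
      e₁ = solve-∀
      e₂ : ∀ b ℓ P → b * ℓ * P + b * P ≡ b * P * (ℓ + 1)
      e₂ = solve-∀
      e₃ : ∀ b P d → b * P * (3 * d) ≡ d * b * (3 * P)
      e₃ = solve-∀

module Lists where

  open import Data.Nat
  open import Data.Nat.Properties
  open import Data.List using (List; []; _∷_; length; map; _++_; [_])
  open import Data.List.Properties using (length-++)
  open import Data.Nat.ListAction using (sum)
  open import Data.List.Membership.Propositional using (_∈_)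
  open import Data.List.Membership.Propositional.Properties using (∈-∃++; ∈-++⁻; ∈-++⁺ˡ; ∈-++⁺ʳ)
  open import Data.List.Relation.Binary.Subset.Propositional using (_⊆_)
  open import Data.List.Relation.Unary.Any using (here; there)
  import Data.List.Relation.Unary.All as All
  open import Data.List.Relation.Unary.AllPairs using (_∷_)
  open import Data.List.Relation.Unary.Unique.Propositional using (Unique)
  open import Data.Product using (_,_)
  open import Data.List.Relation.Unary.Linked using (Linked; [-]; _∷_)
  open import Relation.Binary using (Rel)
  open import Data.Sum using (inj₁; inj₂)
  open import Data.Empty using (⊥-elim)
  open import Algebra.Properties.CommutativeSemigroup +-commutativeSemigroup using (interchange)
  open import Relation.Binary.PropositionalEquality hiding ([_])

  Unique-⊆⇒length≤ : ∀ {a} {A : Set a} {xs ys : List A} → Unique xs → xs ⊆ ys → length xs ≤ length ys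
  Unique-⊆⇒length≤ {xs = []} _ _ = z≤n
  Unique-⊆⇒length≤ {xs = x ∷ xs} {ys} (x∉xs ∷ u) sub with ∈-∃++ (sub (here refl))
  ... | as , bs , refl = begin
    suc (length xs) ≤⟨ s≤s (Unique-⊆⇒length≤ u sub′) ⟩
    suc (length (as ++ bs)) ≡⟨ cong suc (length-++ as) ⟩
    suc (length as + length bs) ≡⟨ sym (+-suc (length as) (length bs)) ⟩
    length as + length (x ∷ bs) ≡⟨ sym (length-++ as) ⟩
    length (as ++ [ x ] ++ bs) ∎
    where
    open ≤-Reasoning
    sub′ : xs ⊆ as ++ bs
    sub′ y∈xs with ∈-++⁻ as (sub (there y∈xs))
    ... | inj₁ y∈as = ∈-++⁺ˡ y∈as
    ... | inj₂ (here refl) = ⊥-elim (All.lookup x∉xs y∈xs refl)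
    ... | inj₂ (there y∈bs) = ∈-++⁺ʳ as y∈bs

  sum-map-+ : ∀ {a} {A : Set a} (f g : A → ℕ) xs →
    sum (map (λ x → f x + g x) xs) ≡ sum (map f xs) + sum (map g xs)
  sum-map-+ f g [] = refl
  sum-map-+ f g (x ∷ xs) = begin
    f x + g x + sum (map (λ x → f x + g x) xs) ≡⟨ cong (f x + g x +_) (sum-map-+ f g xs) ⟩
    f x + g x + (sum (map f xs) + sum (map g xs)) ≡⟨ interchange (f x) (g x) _ _ ⟩
    f x + sum (map f xs) + (g x + sum (map g xs)) ∎
    where open ≡-Reasoning

  nth : List ℕ → ℕ → ℕ
  nth [] _ = 0
  nth (x ∷ _) zero = x
  nth (_ ∷ xs) (suc j) = nth xs j

  Linked-nth : ∀ {ℓ} {R : Rel ℕ ℓ} {xs} j → Linked R xs → suc j < length xs → R (nth xs j) (nth xs (suc j))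
  Linked-nth zero (r ∷ _) _ = r
  Linked-nth (suc j) (_ ∷ rs) (s≤s lt) = Linked-nth j rs lt
  Linked-nth zero [-] (s≤s ())
  Linked-nth (suc j) [-] (s≤s ())

module Counting where

  open import Defs
  open import Data.Nat hiding (_≟_)
  open import Data.Nat.Properties hiding (_≟_)
  open import Data.Fin using (Fin; toℕ; _≟_)
  open import Data.List using (List; []; _∷_; length; filter; take; map; allFin; [_])
  open import Data.List.Properties using (length-map; length-tabulate; map-cong)
  open import Data.Nat.ListAction using (sum)
  open import Data.List.Membership.Propositional using (_∈_)
  open import Data.List.Membership.Propositional.Properties using (∈-map⁺; ∈-filter⁻; ∈-allFin)
  open import Data.List.Relation.Binary.Subset.Propositional using (_⊆_)
  open import Data.List.Relation.Unary.All using (All; []; _∷_)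
  open import Data.List.Relation.Unary.AllPairs using (_∷_)
  open import Data.List.Relation.Unary.Unique.Propositional using (Unique)
  open import Data.List.Relation.Unary.Unique.Propositional.Properties using (filter⁺; map⁺; allFin⁺)
  open import Data.Product using (_,_; proj₁)
  open import Data.Empty using (⊥-elim)
  open import Relation.Nullary using (yes; no)
  open import Relation.Binary.PropositionalEquality hiding ([_])
  open Lists using (Unique-⊆⇒length≤; sum-map-+)

  module _ {N : ℕ} where

    countIn-∷ : ∀ i x (xs : List (Elem N)) → countIn i (x ∷ xs) ≡ countIn i [ x ] + countIn i xs
    countIn-∷ i x xs with proj₁ x ≟ i
    ... | yes _ = refl
    ... | no _ = refl

    countIn-take-mono : ∀ i (xs : List (Elem N)) {k k'} → k ≤ k' → countIn i (take k xs) ≤ countIn i (take k' xs)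
    countIn-take-mono i xs z≤n = z≤n
    countIn-take-mono i [] (s≤s _) = z≤n
    countIn-take-mono i (x ∷ xs) {suc k} {suc k'} (s≤s k≤k') = begin
      countIn i (x ∷ take k xs) ≡⟨ countIn-∷ i x (take k xs) ⟩
      countIn i [ x ] + countIn i (take k xs) ≤⟨ +-monoʳ-≤ (countIn i [ x ]) (countIn-take-mono i xs k≤k') ⟩
      countIn i [ x ] + countIn i (take k' xs) ≡⟨ sym (countIn-∷ i x (take k' xs)) ⟩
      countIn i (x ∷ take k' xs) ∎
      where open ≤-Reasoning

    sum-countIn-[x]≡0 : ∀ (x : Elem N) rs → All (proj₁ x ≢_) rs → sum (map (λ r → countIn r [ x ]) rs) ≡ 0
    sum-countIn-[x]≡0 x [] [] = refl
    sum-countIn-[x]≡0 x (r ∷ rs) (x≢r ∷ x≢rs) with proj₁ x ≟ r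
    ... | yes x≡r = ⊥-elim (x≢r x≡r)
    ... | no _ = sum-countIn-[x]≡0 x rs x≢rs

    sum-countIn-[x]≤1 : ∀ (x : Elem N) rs → Unique rs → sum (map (λ r → countIn r [ x ]) rs) ≤ 1
    sum-countIn-[x]≤1 x [] _ = z≤n
    sum-countIn-[x]≤1 x (r ∷ rs) (r∉rs ∷ u) with proj₁ x ≟ r
    ... | yes refl = ≤-reflexive (cong suc (sum-countIn-[x]≡0 x rs r∉rs))
    ... | no _ = sum-countIn-[x]≤1 x rs u

    sum-countIn≤length : ∀ (xs : List (Elem N)) rs → Unique rs → sum (map (λ r → countIn r xs) rs) ≤ length xs
    sum-countIn≤length [] rs _ = ≤-reflexive (sum-zero rs)
      where
      sum-zero : ∀ rs → sum (map (λ r → countIn r []) rs) ≡ 0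
      sum-zero [] = refl
      sum-zero (_ ∷ rs) = sum-zero rs
    sum-countIn≤length (x ∷ xs) rs u = begin
      sum (map (λ r → countIn r (x ∷ xs)) rs) ≡⟨ cong sum (map-cong (λ r → countIn-∷ r x xs) rs) ⟩
      sum (map (λ r → countIn r [ x ] + countIn r xs) rs)
        ≡⟨ sum-map-+ (λ r → countIn r [ x ]) (λ r → countIn r xs) rs ⟩
      sum (map (λ r → countIn r [ x ]) rs) + sum (map (λ r → countIn r xs) rs)
        ≤⟨ +-mono-≤ (sum-countIn-[x]≤1 x rs u) (sum-countIn≤length xs rs u) ⟩
      suc (length xs) ∎
      where open ≤-Reasoning

    elem : (i : Fin N) → Fin (suc (toℕ i)) → Elem N
    elem i j = i , j

    region : Fin N → List (Elem N)
    region i = map (elem i) (allFin (suc (toℕ i)))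

    length-region : ∀ i → length (region i) ≡ suc (toℕ i)
    length-region i = trans (length-map (elem i) (allFin _)) (length-tabulate (λ j → j))

    region-unique : ∀ i → Unique (region i)
    region-unique i = map⁺ (λ { refl → refl }) (allFin⁺ (suc (toℕ i)))

    countIn-region : ∀ i → countIn i (region i) ≡ suc (toℕ i)
    countIn-region i = trans (countIn-own (allFin _)) (length-region i)
      where
      countIn-own : ∀ js → countIn i (map (elem i) js) ≡ length (map (elem i) js)
      countIn-own [] = refl
      countIn-own (j ∷ js) with i ≟ i
      ... | yes _ = cong suc (countIn-own js)
      ... | no i≢i = ⊥-elim (i≢i refl)

    countIn≤size : ∀ i {xs : List (Elem N)} → Unique xs → countIn i xs ≤ suc (toℕ i)
    countIn≤size i {xs} u = ≤-trans (Unique-⊆⇒length≤ (filter⁺ (λ e → proj₁ e ≟ i) u) in-region)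
                                    (≤-reflexive (length-region i))
      where
      in-region : filter (λ e → proj₁ e ≟ i) xs ⊆ region i
      in-region x∈ with ∈-filter⁻ (λ e → proj₁ e ≟ i) {xs = xs} x∈
      in-region {_ , j} _ | _ , refl = ∈-map⁺ (elem i) (∈-allFin j)

    size≤length : ∀ i {σ : List (Elem N)} → (∀ x → x ∈ σ) → suc (toℕ i) ≤ length σ
    size≤length i all∈ =
      ≤-trans (≤-reflexive (sym (length-region i))) (Unique-⊆⇒length≤ (region-unique i) (λ {x} _ → all∈ x))

module Valuation where

  open import Defs
  open import Data.Nat as ℕ using (ℕ; suc)
  import Data.Nat.Properties as ℕ
  open import Data.Integer as ℤ using (+_; +≤+)
  import Data.Integer.Properties as ℤ
  open import Data.Rational using (ℚ; _/_; 0ℚ; _⊔_; _*_; _≤_; _<_; toℚᵘ)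
  open import Data.Rational.Properties
  open import Data.Rational.Unnormalised as ℚᵘ using (mkℚᵘ; *≤*)
  import Data.Rational.Unnormalised.Properties as ℚᵘ
  open import Data.Fin using (Fin)
  open import Data.List using (List; []; _∷_; map; foldr; allFin)
  open import Data.List.Membership.Propositional using (_∈_)
  open import Data.List.Membership.Propositional.Properties using (∈-map⁺; ∈-map⁻; ∈-allFin)
  open import Data.List.Relation.Unary.Any using (here; there)
  open import Data.Product using (Σ; _×_; _,_)
  open import Data.Sum using (inj₁; inj₂)
  open import Data.Empty using (⊥-elim)
  open import Relation.Binary.PropositionalEquality

  toℚᵘ-/suc : ∀ n k → toℚᵘ (+ n / suc k) ℚᵘ.≃ mkℚᵘ (+ n) k
  toℚᵘ-/suc n k = toℚᵘ-fromℚᵘ (mkℚᵘ (+ n) k)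

  toℚᵘ-ℕ*1/suc : ∀ c k → toℚᵘ (ℕtoℚ c * (+ 1 / suc k)) ℚᵘ.≃ mkℚᵘ (+ c) 0 ℚᵘ.* mkℚᵘ (+ 1) k
  toℚᵘ-ℕ*1/suc c k =
    ℚᵘ.≃-trans (toℚᵘ-homo-* (ℕtoℚ c) (+ 1 / suc k)) (ℚᵘ.*-cong (toℚᵘ-/suc c 0) (toℚᵘ-/suc 1 k))

  ≤-ℕ*1/⇒ : ∀ w c n .{{_ : ℕ.NonZero n}} → ℕtoℚ w ≤ ℕtoℚ c * (+ 1 / n) → w ℕ.* n ℕ.≤ c
  ≤-ℕ*1/⇒ w c (suc k) le
    with ℚᵘ.≤-respˡ-≃ (toℚᵘ-/suc w 0) (ℚᵘ.≤-respʳ-≃ (toℚᵘ-ℕ*1/suc c k) (toℚᵘ-mono-≤ le))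
  ... | *≤* cross = begin
    w ℕ.* suc k ≡⟨ cong (λ x → w ℕ.* suc x) (sym (ℕ.+-identityʳ k)) ⟩
    w ℕ.* suc (k ℕ.+ 0) ≤⟨ ℤ.drop‿+≤+ (subst₂ ℤ._≤_ (sym (ℤ.pos-* w _)) rhs cross) ⟩
    c ℕ.* 1 ℕ.* 1 ≡⟨ trans (ℕ.*-identityʳ (c ℕ.* 1)) (ℕ.*-identityʳ c) ⟩
    c ∎
    where
    open ℕ.≤-Reasoning
    rhs : (+ c ℤ.* + 1) ℤ.* + 1 ≡ + (c ℕ.* 1 ℕ.* 1)
    rhs = trans (cong (ℤ._* + 1) (sym (ℤ.pos-* c 1))) (sym (ℤ.pos-* (c ℕ.* 1) 1))

  ⇒≤-ℕ*1/ : ∀ w c n .{{_ : ℕ.NonZero n}} → w ℕ.* n ℕ.≤ c → ℕtoℚ w ≤ ℕtoℚ c * (+ 1 / n)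
  ⇒≤-ℕ*1/ w c (suc k) le =
    toℚᵘ-cancel-≤ (ℚᵘ.≤-respˡ-≃ (ℚᵘ.≃-sym (toℚᵘ-/suc w 0))
                                (ℚᵘ.≤-respʳ-≃ (ℚᵘ.≃-sym (toℚᵘ-ℕ*1/suc c k)) (*≤* cross)))
    where
    cross : + w ℤ.* + suc (k ℕ.+ 0) ℤ.≤ (+ c ℤ.* + 1) ℤ.* + 1
    cross = subst₂ ℤ._≤_ (ℤ.pos-* w _) (trans (ℤ.pos-* (c ℕ.* 1) 1) (cong (ℤ._* + 1) (ℤ.pos-* c 1)))
      (+≤+ (subst₂ ℕ._≤_ (cong (λ x → w ℕ.* suc x) (sym (ℕ.+-identityʳ k)))
                          (sym (trans (ℕ.*-identityʳ (c ℕ.* 1)) (ℕ.*-identityʳ c))) le))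

  ρ*-≤ : ∀ x y → 109 ℕ.* x ℕ.≤ 50 ℕ.* y → (+ 109 / 50) * ℕtoℚ x ≤ ℕtoℚ y
  ρ*-≤ x y le =
    toℚᵘ-cancel-≤ (ℚᵘ.≤-respˡ-≃ (ℚᵘ.≃-sym lhs) (ℚᵘ.≤-respʳ-≃ (ℚᵘ.≃-sym (toℚᵘ-/suc y 0)) (*≤* cross)))
    where
    lhs : toℚᵘ ((+ 109 / 50) * ℕtoℚ x) ℚᵘ.≃ mkℚᵘ (+ 109) 49 ℚᵘ.* mkℚᵘ (+ x) 0
    lhs = ℚᵘ.≃-trans (toℚᵘ-homo-* (+ 109 / 50) (ℕtoℚ x)) (ℚᵘ.*-cong (toℚᵘ-/suc 109 49) (toℚᵘ-/suc x 0))
    cross : (+ 109 ℤ.* + x) ℤ.* + 1 ℤ.≤ + y ℤ.* + 50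
    cross = subst₂ ℤ._≤_ (trans (ℤ.pos-* (109 ℕ.* x) 1) (cong (ℤ._* + 1) (ℤ.pos-* 109 x))) (ℤ.pos-* y 50)
      (+≤+ (subst₂ ℕ._≤_ (sym (ℕ.*-identityʳ (109 ℕ.* x))) (ℕ.*-comm 50 y) le))

  0<ℕtoℚ : ∀ n .{{_ : ℕ.NonZero n}} → 0ℚ < ℕtoℚ n
  0<ℕtoℚ n = positive⁻¹ (ℕtoℚ n) {{normalize-pos n 1}}

  ≤-foldr-⊔ : ∀ {y} ys → y ∈ ys → y ≤ foldr _⊔_ 0ℚ ys
  ≤-foldr-⊔ (y ∷ ys) (here refl) = p≤p⊔q y _
  ≤-foldr-⊔ (y′ ∷ ys) (there y∈ys) = ≤-trans (≤-foldr-⊔ ys y∈ys) (p≤q⊔p y′ _)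

  foldr-⊔-witness : ∀ {w} ys → 0ℚ < w → w ≤ foldr _⊔_ 0ℚ ys → Σ ℚ λ y → y ∈ ys × w ≤ y
  foldr-⊔-witness [] 0<w w≤0 = ⊥-elim (<-irrefl refl (<-≤-trans 0<w w≤0))
  foldr-⊔-witness (y ∷ ys) 0<w w≤ with ⊔-sel y (foldr _⊔_ 0ℚ ys)
  ... | inj₁ eq = y , here refl , subst (_ ≤_) eq w≤
  ... | inj₂ eq with foldr-⊔-witness ys 0<w (subst (_ ≤_) eq w≤)
  ...   | y′ , y′∈ys , w≤y′ = y′ , there y′∈ys , w≤y′

  module _ {N : ℕ} (δ : Fin N → ℚ) where

    value : List (Elem N) → Fin N → ℚ
    value S i = ℕtoℚ (countIn i S) * δ i

    value≤f : ∀ S i → ℕtoℚ (countIn i S) * δ i ≤ f δ S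
    value≤f S i = ≤-foldr-⊔ (map (value S) (allFin N)) (∈-map⁺ (value S) (∈-allFin i))

    f-witness : ∀ {w} S → 0ℚ < w → w ≤ f δ S → Σ (Fin N) λ i → w ≤ ℕtoℚ (countIn i S) * δ i
    f-witness S 0<w w≤f with foldr-⊔-witness (map (value S) (allFin N)) 0<w w≤f
    ... | y , y∈ , w≤y with ∈-map⁻ (value S) y∈
    ...   | i , _ , refl = i , w≤y

module Constants where

  open import Data.Nat
  open import Data.Nat.Properties using (_≤?_; ≤ᵇ⇒≤)
  open import Data.List using (List; []; _∷_)
  open import Data.List.Relation.Unary.Linked using (linked?)
  open import Data.Unit using (tt)
  open import Relation.Binary using (Decidable)
  open import Relation.Nullary.Decidable using (toWitness)
  open Lists using (nth; Linked-nth)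

  -- Abstract, so that the type checker never unfolds them.  (K/A)^6 ≥ 109/50; for p ≥ m₀,
  -- (K(p+1)/(A p))^7 ≤ (G/H)^7 ≤ ℓ/d; E absorbs the loss from side ≥ A t − 2; ratios are
  -- b times certified values of the recurrence of Improves, the last exceeding ℓ/d − 1 + 1/E.
  abstract
    A K m₀ E b ℓ d G H M : ℕ
    A = 100000
    K = 113871
    m₀ = 100000
    E = 100000
    b = 1000000
    ℓ = 24830
    d = 10000
    G = 113873
    H = 100000
    M = suc (3 ^ 28 * m₀)

    ratios : List ℕ
    ratios = 999990 ∷ 1063372 ∷ 1091494 ∷ 1108034 ∷ 1119247 ∷ 1127561 ∷ 1134129 ∷ 1139577 ∷
      1144278 ∷ 1148472 ∷ 1152326 ∷ 1155963 ∷ 1159482 ∷ 1162969 ∷ 1166506 ∷ 1170179 ∷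
      1174086 ∷ 1178350 ∷ 1183134 ∷ 1188667 ∷ 1195295 ∷ 1203570 ∷ 1214442 ∷ 1229700 ∷
      1253146 ∷ 1294433 ∷ 1386257 ∷ 1726232 ∷ []

  open Arithmetic.Recurrence b ℓ d E public

  ratio : ℕ → ℕ
  ratio = nth ratios

  checkpoint : ℕ → ℕ
  checkpoint m = (K * m) ^ 7

  abstract
    0<A : 0 < A
    0<A = z<s
    0<K : 0 < K
    0<K = z<s
    0<m₀ : 0 < m₀
    0<m₀ = z<s
    0<E : 0 < E
    0<E = z<s
    0<H : 0 < H
    0<H = z<s
    0<db : 0 < d * b
    0<db = z<s

    m₀≤M : m₀ ≤ M
    m₀≤M = ≤ᵇ⇒≤ _ _ tt
    3²⁸m₀<M : 3 ^ 28 * m₀ < M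
    3²⁸m₀<M = ≤ᵇ⇒≤ _ _ tt

    2E≤Am₀ : 2 * E ≤ A * m₀
    2E≤Am₀ = ≤ᵇ⇒≤ _ _ tt
    2d≤Am₀ : 2 * d ≤ A * m₀
    2d≤Am₀ = ≤ᵇ⇒≤ _ _ tt

    ρ-gap : 109 * A ^ 6 ≤ 50 * K ^ 6
    ρ-gap = ≤ᵇ⇒≤ _ _ tt
    side-gap : K ^ 7 + 2 * A ^ 6 ≤ 3 * A ^ 7
    side-gap = ≤ᵇ⇒≤ _ _ tt
    ℓ-gap : ℓ + 1 ≤ 3 * d
    ℓ-gap = ≤ᵇ⇒≤ _ _ tt

    scale-HK≤ : H * K ≤ (G * A ∸ H * K) * m₀
    scale-HK≤ = ≤ᵇ⇒≤ _ _ tt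
    scale-HK≤GA : H * K ≤ G * A
    scale-HK≤GA = ≤ᵇ⇒≤ _ _ tt
    scale-G≤H : d * G ^ 7 ≤ ℓ * H ^ 7
    scale-G≤H = ≤ᵇ⇒≤ _ _ tt

    ratio-start : ratio 0 * E ≤ b * (E ∸ 1)
    ratio-start = ≤ᵇ⇒≤ _ _ tt
    ratio-improves : ∀ j → j < 27 → Improves (ratio j) (ratio (suc j))
    ratio-improves j j<27 = Linked-nth j (toWitness {a? = linked? improves? ratios} tt) (s≤s j<27)
      where
      improves? : Decidable Improves
      improves? a a' = _ ≤? _
    ratio-exhausted : den (ratio 27) < E * d * b
    ratio-exhausted = ≤ᵇ⇒≤ _ _ tt

module Chain where

  open import Data.Nat
  open import Data.Nat.Properties
  open import Data.Nat.Induction using (<-rec)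
  open import Data.List using (List; []; _∷_; map)
  open import Data.Nat.ListAction using (sum)
  open import Data.List.Relation.Unary.All as All using (All; []; _∷_)
  open import Data.List.Relation.Unary.AllPairs using ([]; _∷_)
  open import Data.List.Relation.Unary.Unique.Propositional using (Unique)
  open import Data.Product using (Σ; _×_; _,_)
  open import Data.Sum using (_⊎_; inj₁; inj₂)
  open import Data.Empty using (⊥; ⊥-elim)
  open import Relation.Nullary using (¬_; yes; no)
  open import Relation.Unary using (Pred; Decidable)
  open import Relation.Binary.PropositionalEquality
  open import Algebra.Properties.CommutativeSemigroup *-commutativeSemigroup using (x∙yz≈y∙xz)
  open Arithmetic using (consecutive-scale; growth-base)
  open Constants

  ¬-below-suc : ∀ {p} {P : Pred ℕ p} {r t} → ¬ P t → (r < t → ¬ P r) → r < suc t → ¬ P r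
  ¬-below-suc ¬Pt ¬P r<1+t with m<1+n⇒m<n∨m≡n r<1+t
  ... | inj₁ r<t = ¬P r<t
  ... | inj₂ refl = ¬Pt

  last-below : ∀ {p} {P : Pred ℕ p} → Decidable P → ∀ lo t →
    (Σ ℕ λ q → lo ≤ q × q < t × P q × (∀ r → q < r → r < t → ¬ P r)) ⊎
    (∀ r → lo ≤ r → r < t → ¬ P r)
  last-below P? lo zero = inj₂ λ _ _ ()
  last-below P? lo (suc t) with lo ≤? t
  ... | no lo≰t = inj₂ λ r lo≤r r≤t _ → lo≰t (≤-trans lo≤r (m<1+n⇒m≤n r≤t))
  ... | yes lo≤t with P? t
  ...   | yes Pt = inj₁ (t , lo≤t , ≤-refl , Pt , λ r t<r r≤t _ → <⇒≱ t<r (m<1+n⇒m≤n r≤t))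
  ...   | no ¬Pt with last-below P? lo t
  ...     | inj₁ (q , lo≤q , q<t , Pq , after) =
              inj₁ (q , lo≤q , m≤n⇒m≤1+n q<t , Pq , λ r q<r → ¬-below-suc ¬Pt (after r q<r))
  ...     | inj₂ none = inj₂ λ r lo≤r → ¬-below-suc ¬Pt (none r lo≤r)

  module _ {Reg : Set} (size side : Reg → ℕ) (heavy : ℕ → Reg) (cnt : ℕ → Reg → ℕ)
    (cnt-mono : ∀ r {m m'} → m ≤ m' → cnt m r ≤ cnt m' r)
    (sum-cnt≤ : ∀ m rs → Unique rs → sum (map (cnt m) rs) ≤ checkpoint m)
    (heavy-weight : ∀ m → m₀ ≤ m → m ≤ M → (A * m) ^ 6 * side (heavy m) ≤ cnt m (heavy m))
    (heavy-side : ∀ m → m₀ ≤ m → m ≤ M → A * m ≤ side (heavy m) + 2)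
    (side-mono : ∀ {r r'} → size r ≤ size r' → side r ≤ side r')
    where

    weight : ℕ → ℕ
    weight t = (A * t) ^ 6 * side (heavy t)

    Above : ℕ → List Reg → Set
    Above t rs = All (λ r → size (heavy t) < size r) rs

    Reserves : ℕ → ℕ → Set
    Reserves t C = ∀ m rs → t ≤ m → Unique rs → Above t rs → C + sum (map (cnt m) rs) ≤ checkpoint m

    weight+sum≤ : ∀ {t m} rs → m₀ ≤ t → t ≤ M → t ≤ m →
      weight t + sum (map (cnt m) rs) ≤ sum (map (cnt m) (heavy t ∷ rs))
    weight+sum≤ rs m₀≤t t≤M t≤m = +-monoˡ-≤ _ (≤-trans (heavy-weight _ m₀≤t t≤M) (cnt-mono _ t≤m))

    heavy∷-unique : ∀ {t rs} → Above t rs → Unique rs → Unique (heavy t ∷ rs)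
    heavy∷-unique above u = All.map (λ lt eq → <-irrefl (cong size eq) lt) above ∷ u

    reserves-start : ∀ {t} → m₀ ≤ t → t ≤ M → Reserves t (weight t)
    reserves-start m₀≤t t≤M m rs t≤m u above =
      ≤-trans (weight+sum≤ rs m₀≤t t≤M t≤m) (sum-cnt≤ m _ (heavy∷-unique above u))

    reserves-extend : ∀ {p t C} → Reserves p C → m₀ ≤ t → t ≤ M → p ≤ t → size (heavy p) < size (heavy t) →
      Reserves t (C + weight t)
    reserves-extend {t = t} {C} reserved m₀≤t t≤M p≤t smaller m rs t≤m u above = begin
      C + weight t + sum (map (cnt m) rs) ≡⟨ +-assoc C _ _ ⟩
      C + (weight t + sum (map (cnt m) rs)) ≤⟨ +-monoʳ-≤ C (weight+sum≤ rs m₀≤t t≤M t≤m) ⟩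
      C + sum (map (cnt m) (heavy _ ∷ rs)) ≤⟨ reserved m _ (≤-trans p≤t t≤m) (heavy∷-unique above u)
                                              (smaller ∷ All.map (<-trans smaller) above) ⟩
      checkpoint m ∎
      where open ≤-Reasoning

    weight≤checkpoint : ∀ {t} → m₀ ≤ t → t ≤ M → weight t ≤ checkpoint t
    weight≤checkpoint m₀≤t t≤M =
      ≤-trans (≤-reflexive (sym (+-identityʳ _))) (reserves-start m₀≤t t≤M _ [] ≤-refl [] [])

    record Chain (t : ℕ) : Set where
      field
        depth : ℕ
        depth≤27 : depth ≤ 27
        mass : ℕ
        mass-ratio : ratio depth * (A * t) ^ 7 ≤ b * mass
        time-bound : t ≤ 3 ^ suc depth * m₀
        reserves : Reserves t mass

    2E≤Ap : ∀ {p} → m₀ ≤ p → 2 * E ≤ A * p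
    2E≤Ap m₀≤p = ≤-trans 2E≤Am₀ (*-monoʳ-≤ A m₀≤p)

    chain-start : ∀ {t} → m₀ ≤ t → t ≤ M → size (heavy t) ≤ size (heavy m₀) → Chain t
    chain-start {t} m₀≤t t≤M not-larger = record
      { depth = 0
      ; depth≤27 = z≤n
      ; mass = weight t
      ; mass-ratio = ratio-base {ratio 0} 0<E ratio-start (side-slack (heavy-side t m₀≤t t≤M) (2E≤Ap m₀≤t))
      ; time-bound = subst (λ x → t ≤ x * m₀) (sym (*-identityʳ 3))
          (growth-base {K = K} 0<A 0<m₀ side-gap (weight≤checkpoint ≤-refl m₀≤M) (side-mono not-larger)
                       (heavy-side t m₀≤t t≤M))
      ; reserves = reserves-start m₀≤t t≤M
      }

    record LastSmaller (p t : ℕ) : Set where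
      field
        m₀≤p : m₀ ≤ p
        p<t : p < t
        t≤M : t ≤ M
        smaller : size (heavy p) < size (heavy t)
        next : size (heavy t) ≤ size (heavy (suc p))

      m₀≤t : m₀ ≤ t
      m₀≤t = ≤-trans m₀≤p (<⇒≤ p<t)

      p≤M : p ≤ M
      p≤M = ≤-trans (<⇒≤ p<t) t≤M

      0<Ap : 0 < A * p
      0<Ap = *-mono-≤ 0<A (≤-trans 0<m₀ m₀≤p)

      Ap≤side+2 : A * p ≤ side (heavy t) + 2
      Ap≤side+2 = ≤-trans (heavy-side p m₀≤p p≤M) (+-monoˡ-≤ 2 (side-mono (<⇒≤ smaller)))

    extension-capacity : ∀ {p t} (c : Chain p) → LastSmaller p t →
      d * b * side (heavy t) ≤ (b * ℓ ∸ d * ratio (Chain.depth c)) * (A * p)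
    extension-capacity {p} {t} c s = capacity 0<Ap mass-ratio (begin
      d * (mass + (A * p) ^ 6 * side (heavy t)) ≤⟨ *-monoʳ-≤ d (+-monoʳ-≤ mass next-weight) ⟩
      d * (mass + (cnt (suc p) (heavy (suc p)) + 0))
        ≤⟨ *-monoʳ-≤ d (reserves (suc p) (heavy (suc p) ∷ []) (n≤1+n p) ([] ∷ [])
                                 (<-≤-trans smaller next ∷ [])) ⟩
      d * checkpoint (suc p)
        ≤⟨ consecutive-scale {K} {A} {G} {H} {d} {ℓ} 0<H scale-HK≤ scale-HK≤GA scale-G≤H m₀≤p ⟩
      ℓ * (A * p) ^ 7 ∎)
      where
      open ≤-Reasoning
      open Chain c
      open LastSmaller s
      next-weight : (A * p) ^ 6 * side (heavy t) ≤ cnt (suc p) (heavy (suc p)) + 0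
      next-weight = begin
        (A * p) ^ 6 * side (heavy t) ≤⟨ *-mono-≤ (^-monoˡ-≤ 6 (*-monoʳ-≤ A (n≤1+n p))) (side-mono next) ⟩
        weight (suc p) ≤⟨ heavy-weight (suc p) (≤-trans m₀≤p (n≤1+n p)) (≤-trans p<t t≤M) ⟩
        cnt (suc p) (heavy (suc p)) ≡⟨ sym (+-identityʳ _) ⟩
        cnt (suc p) (heavy (suc p)) + 0 ∎

    extension-depth<27 : ∀ {p t} (c : Chain p) → LastSmaller p t → Chain.depth c < 27
    extension-depth<27 {p} c s with Chain.depth c ≟ 27
    ... | no depth≢27 = ≤∧≢⇒< (Chain.depth≤27 c) depth≢27
    ... | yes depth≡27 = ⊥-elim (<⇒≱ ratio-exhausted (subst (λ j → E * d * b ≤ den (ratio j)) depth≡27 no-room))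
      where
      open LastSmaller s
      no-room : E * d * b ≤ den (ratio (Chain.depth c))
      no-room = *-cancelʳ-≤ _ _ (A * p) {{>-nonZero 0<Ap}} (den-bound (extension-capacity c s) Ap≤side+2 (2E≤Ap m₀≤p))

    chain-extend : ∀ {p t} → Chain p → LastSmaller p t → Chain t
    chain-extend {p} {t} c s = record
      { depth = suc depth
      ; depth≤27 = extension-depth<27 c s
      ; mass = mass + weight t
      ; mass-ratio = ratio-step {ratio depth} {ratio (suc depth)} 0<db 0<E
          (ratio-improves depth (extension-depth<27 c s)) mass-ratio
          (den-bound cap (heavy-side t m₀≤t t≤M) (2E≤Ap m₀≤p))
          (side-slack (heavy-side t m₀≤t t≤M) (2E≤Ap m₀≤t))
      ; time-bound = begin
          t ≤⟨ t≤3p ⟩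
          3 * p ≤⟨ *-monoʳ-≤ 3 time-bound ⟩
          3 * (3 ^ suc depth * m₀) ≡⟨ sym (*-assoc 3 (3 ^ suc depth) m₀) ⟩
          3 ^ suc (suc depth) * m₀ ∎
      ; reserves = reserves-extend reserves m₀≤t t≤M (<⇒≤ p<t) smaller
      }
      where
      open ≤-Reasoning
      open Chain c
      open LastSmaller s
      cap : d * b * side (heavy t) ≤ (b * ℓ ∸ d * ratio depth) * (A * p)
      cap = extension-capacity c s
      t≤3p : t ≤ 3 * p
      t≤3p = *-cancelˡ-≤ A {{>-nonZero 0<A}} (≤-trans
        (growth-step 0<db ℓ-gap cap (heavy-side t m₀≤t t≤M) (≤-trans 2d≤Am₀ (*-monoʳ-≤ A m₀≤p)))
        (≤-reflexive (x∙yz≈y∙xz 3 A p)))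

    not-smaller : ∀ {q t} → q ≤ t → (q < t → ¬ size (heavy q) < size (heavy t)) → size (heavy t) ≤ size (heavy q)
    not-smaller q≤t ¬smaller with m≤n⇒m<n∨m≡n q≤t
    ... | inj₁ q<t = ≮⇒≥ (¬smaller q<t)
    ... | inj₂ refl = ≤-refl

    chain-from-earlier : ∀ t → (∀ {p} → p < t → m₀ ≤ p → p ≤ M → Chain p) →
      m₀ ≤ t → t ≤ M → Chain t
    chain-from-earlier t earlier m₀≤t t≤M with last-below (λ q → size (heavy q) <? size (heavy t)) m₀ t
    ... | inj₂ none = chain-start m₀≤t t≤M (not-smaller m₀≤t (none m₀ ≤-refl))
    ... | inj₁ (p , m₀≤p , p<t , smaller , after) =
      chain-extend (earlier p<t m₀≤p (≤-trans (<⇒≤ p<t) t≤M)) record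
      { m₀≤p = m₀≤p ; p<t = p<t ; t≤M = t≤M ; smaller = smaller
      ; next = not-smaller p<t (after (suc p) ≤-refl) }

    chain : ∀ t → m₀ ≤ t → t ≤ M → Chain t
    chain = <-rec (λ t → m₀ ≤ t → t ≤ M → Chain t) chain-from-earlier

    no-chain-at-M : ⊥
    no-chain-at-M = <⇒≱ 3²⁸m₀<M (≤-trans time-bound (*-monoˡ-≤ m₀ (^-monoʳ-≤ 3 (s≤s depth≤27))))
      where
      open Chain (chain M m₀≤M ≤-refl)

module Instance where

  open import Defs
  open import Data.Nat as ℕ using (ℕ; suc; _^_; NonZero; >-nonZero)
  import Data.Nat.Properties as ℕ
  open import Data.Fin using (Fin; toℕ; fromℕ<)
  open import Data.Fin.Properties using (toℕ-fromℕ<)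
  open import Data.Integer using (+_)
  open import Data.Rational using (ℚ; _/_; 0ℚ; _*_; _≤_)
  open import Data.Rational.Properties using (nonNegative⁻¹; normalize-nonNeg; *-cancelˡ-≤-pos; module ≤-Reasoning)
  open import Data.List using (List; take; length; map)
  open import Data.Nat.ListAction using (sum)
  open import Data.List.Properties using (length-take)
  open import Data.List.Membership.Propositional using (_∈_)
  open import Data.List.Relation.Unary.Unique.Propositional using (Unique)
  open import Data.List.Relation.Unary.Unique.Propositional.Properties using (take⁺)
  open import Data.Product using (Σ; _,_; proj₁; proj₂; map₂)
  open import Data.Empty using (⊥; ⊥-elim)
  open import Relation.Nullary using (Dec; yes; no)
  open import Relation.Binary.PropositionalEquality
  open Root using (root; root-nonZero; <suc-root-^; root-unique; root-mono-≤)
  open Arithmetic using (*-^-scale; ^-*-<⇒≤+2)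
  open Constants
  open Counting
  open Valuation

  -- suc ∘ pred makes the denominator of density visibly nonzero; by side≡root it changes nothing.
  side : ∀ {N} → Fin N → ℕ
  side i = suc (ℕ.pred (root 7 (suc (toℕ i))))

  side≡root : ∀ {N} (i : Fin N) → side i ≡ root 7 (suc (toℕ i))
  side≡root i = ℕ.suc-pred (root 7 (suc (toℕ i))) {{root-nonZero 7 (suc (toℕ i))}}

  density : ∀ {N} → Fin N → ℚ
  density i = + 1 / side i

  density-nonNeg : ∀ {N} (i : Fin N) → 0ℚ ≤ density i
  density-nonNeg i = nonNegative⁻¹ (density i) {{normalize-nonNeg 1 (side i)}}

  side-mono : ∀ {N} {i j : Fin N} → suc (toℕ i) ℕ.≤ suc (toℕ j) → side i ℕ.≤ side j
  side-mono {i = i} {j} le = subst₂ ℕ._≤_ (sym (side≡root i)) (sym (side≡root j)) (root-mono-≤ 7 le)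

  countIn<side : ∀ {N} (i : Fin N) {xs} → Unique xs → countIn i xs ℕ.< suc (side i) ^ 7
  countIn<side i u = ℕ.≤-<-trans (countIn≤size i u)
    (subst (λ s → suc (toℕ i) ℕ.< suc s ^ 7) (sym (side≡root i)) (<suc-root-^ 7 (suc (toℕ i))))

  fin-of-size : ∀ {N k} → 0 ℕ.< k → k ℕ.≤ N → Σ (Fin N) λ i → suc (toℕ i) ≡ k
  fin-of-size {k = suc k} _ k<N = fromℕ< k<N , cong suc (toℕ-fromℕ< k<N)

  checkpoint-mono : ∀ {m m'} → m ℕ.≤ m' → checkpoint m ℕ.≤ checkpoint m'
  checkpoint-mono le = ℕ.^-monoˡ-≤ 7 (ℕ.*-monoʳ-≤ K le)

  module Refutation {N : ℕ} {σ : List (Elem N)} (large : checkpoint M ℕ.≤ N) (unique : Unique σ)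
    (covers : ∀ x → x ∈ σ) (competitive : Competitive (+ 109 / 50) density σ) where

    cnt : ℕ → Fin N → ℕ
    cnt m r = countIn r (take (checkpoint m) σ)

    prefix-value : ∀ {m} → m₀ ℕ.≤ m → m ℕ.≤ M →
      ℕtoℚ ((A ℕ.* m) ^ 6) ≤ f density (take (checkpoint m) σ)
    prefix-value {m} m₀≤m m≤M = *-cancelˡ-≤-pos (+ 109 / 50) (begin
      (+ 109 / 50) * ℕtoℚ ((A ℕ.* m) ^ 6)
        ≤⟨ ρ*-≤ ((A ℕ.* m) ^ 6) (u ^ 6) (*-^-scale {109} {50} {A} {K} 6 m ρ-gap) ⟩
      ℕtoℚ (u ^ 6) ≤⟨ ⇒≤-ℕ*1/ (u ^ 6) (countIn i (region i)) (side i) (ℕ.≤-reflexive full-region) ⟩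
      ℕtoℚ (countIn i (region i)) * density i ≤⟨ value≤f density (region i) i ⟩
      f density (region i)
        ≤⟨ competitive k (ℕ.m^n>0 u 7) k≤length (region i) (region-unique i) (trans (length-region i) size≡k) ⟩
      (+ 109 / 50) * f density (take k σ) ∎)
      where
      open ≤-Reasoning
      u : ℕ
      u = K ℕ.* m
      k : ℕ
      k = checkpoint m
      instance
        u≢0 : NonZero u
        u≢0 = >-nonZero (ℕ.*-mono-≤ 0<K (ℕ.≤-trans 0<m₀ m₀≤m))
      region-k : Σ (Fin N) λ i → suc (toℕ i) ≡ k
      region-k = fin-of-size (ℕ.m^n>0 u 7) (ℕ.≤-trans (checkpoint-mono m≤M) large)
      i : Fin N
      i = proj₁ region-k
      size≡k : suc (toℕ i) ≡ k
      size≡k = proj₂ region-k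
      k≤length : k ℕ.≤ length σ
      k≤length = subst (ℕ._≤ length σ) size≡k (size≤length i covers)
      side≡u : side i ≡ u
      side≡u = trans (side≡root i)
        (trans (cong (root 7) size≡k) (root-unique 7 k u ℕ.≤-refl (ℕ.^-monoˡ-< 7 (ℕ.n<1+n u))))
      full-region : u ^ 6 ℕ.* side i ≡ countIn i (region i)
      full-region = trans (cong (u ^ 6 ℕ.*_) side≡u)
        (trans (ℕ.*-comm (u ^ 6) u) (sym (trans (countIn-region i) size≡k)))

    heavy-witness : ∀ {m} → m₀ ℕ.≤ m → m ℕ.≤ M →
      Σ (Fin N) λ r → ℕtoℚ ((A ℕ.* m) ^ 6) ≤ ℕtoℚ (cnt m r) * density r
    heavy-witness {m} m₀≤m m≤M =
      f-witness density (take (checkpoint m) σ) (0<ℕtoℚ ((A ℕ.* m) ^ 6) {{Am⁶≢0}}) (prefix-value m₀≤m m≤M)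
      where
      Am⁶≢0 : NonZero ((A ℕ.* m) ^ 6)
      Am⁶≢0 = ℕ.m^n≢0 (A ℕ.* m) 6 {{>-nonZero (ℕ.*-mono-≤ 0<A (ℕ.≤-trans 0<m₀ m₀≤m))}}

    heavy-exists : ∀ {m} → m₀ ℕ.≤ m → m ℕ.≤ M → Σ (Fin N) λ r → (A ℕ.* m) ^ 6 ℕ.* side r ℕ.≤ cnt m r
    heavy-exists {m} m₀≤m m≤M =
      map₂ (λ {r} → ≤-ℕ*1/⇒ ((A ℕ.* m) ^ 6) (cnt m r) (side r)) (heavy-witness m₀≤m m≤M)

    heavy-if : ∀ {m} → Dec (m₀ ℕ.≤ m) → Dec (m ℕ.≤ M) → Fin N
    heavy-if (yes m₀≤m) (yes m≤M) = proj₁ (heavy-exists m₀≤m m≤M)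
    heavy-if _ _ = proj₁ (heavy-exists ℕ.≤-refl m₀≤M)

    heavy-if-weight : ∀ {m} (m₀≤?m : Dec (m₀ ℕ.≤ m)) (m≤?M : Dec (m ℕ.≤ M)) → m₀ ℕ.≤ m → m ℕ.≤ M →
      (A ℕ.* m) ^ 6 ℕ.* side (heavy-if m₀≤?m m≤?M) ℕ.≤ cnt m (heavy-if m₀≤?m m≤?M)
    heavy-if-weight (yes m₀≤m) (yes m≤M) _ _ = proj₂ (heavy-exists m₀≤m m≤M)
    heavy-if-weight (no m₀≰m) _ m₀≤m _ = ⊥-elim (m₀≰m m₀≤m)
    heavy-if-weight (yes _) (no m≰M) _ m≤M = ⊥-elim (m≰M m≤M)

    heavy : ℕ → Fin N
    heavy m = heavy-if (m₀ ℕ.≤? m) (m ℕ.≤? M)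

    heavy-weight : ∀ m → m₀ ℕ.≤ m → m ℕ.≤ M → (A ℕ.* m) ^ 6 ℕ.* side (heavy m) ℕ.≤ cnt m (heavy m)
    heavy-weight m = heavy-if-weight (m₀ ℕ.≤? m) (m ℕ.≤? M)

    heavy-side : ∀ m → m₀ ℕ.≤ m → m ℕ.≤ M → A ℕ.* m ℕ.≤ side (heavy m) ℕ.+ 2
    heavy-side m m₀≤m m≤M = ^-*-<⇒≤+2 5 ℕ.z<s
      (ℕ.≤-<-trans (heavy-weight m m₀≤m m≤M) (countIn<side (heavy m) (take⁺ (checkpoint m) unique)))

    cnt-mono : ∀ r {m m'} → m ℕ.≤ m' → cnt m r ℕ.≤ cnt m' r
    cnt-mono r le = countIn-take-mono r σ (checkpoint-mono le)

    sum-cnt≤ : ∀ m rs → Unique rs → sum (map (cnt m) rs) ℕ.≤ checkpoint m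
    sum-cnt≤ m rs u = ℕ.≤-trans (sum-countIn≤length (take (checkpoint m) σ) rs u)
      (ℕ.≤-trans (ℕ.≤-reflexive (length-take (checkpoint m) σ)) (ℕ.m⊓n≤m (checkpoint m) (length σ)))

    contradiction : ⊥
    contradiction = Chain.no-chain-at-M (λ r → suc (toℕ r)) side heavy cnt
      cnt-mono sum-cnt≤ heavy-weight heavy-side side-mono

open import Defs
open import Data.Nat using (ℕ; suc)
open import Data.Nat.Properties using (n≤1+n)
open import Data.Fin using (Fin)
open import Data.Integer using (+_)
open import Data.Rational using (ℚ; _/_; 0ℚ; _≤_)
open import Data.List using (List)
open import Data.Product using (Σ; _×_; _,_)
open import Relation.Nullary using (¬_)
open Constants using (checkpoint; M)
open Instance using (density; density-nonNeg; module Refutation)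

theorem14 : Σ ℕ λ N → Σ (Fin N → ℚ) λ δ →
  ((i : Fin N) → 0ℚ ≤ δ i) ×
  ¬ (Σ (List (Elem N)) λ σ → IsOrdering σ × Competitive (+ 109 / 50) δ σ)
theorem14 = suc (checkpoint M) , density , density-nonNeg ,
  λ (σ , (unique , covers) , competitive) → Refutation.contradiction (n≤1+n _) unique covers competitive
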